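{- Without a uniform bound on height the well-quasi-order property fails: there exist a finite set $\mathsf{PROP}$ of propositional symbols and classes of finite pointed tree-shaped Kripke models over $\mathsf{PROP}$ (of unbounded height) such that the embedding relation on one such class is not a well-quasi-order, the injective homomorphism relation on one such class is not a well-quasi-order, and the homomorphism relation on one such class is not a well-quasi-order.
   Context: A Kripke model is $\mathfrak{M}=(W,R,V)$ with $W$ non-empty finite, $R\subseteq W\times W$, $V:\mathsf{PROP}\to 2^W$; a pointed model is $(\mathfrak{M},w)$. It is tree-shaped if every $v\in W$ has a unique directed $R$-path from $w$; its height is the length of the longest directed path from $w$. For $\mathfrak{N}=(W',R',V')$ and $f:W\to W'$ with $f(w)=v$: $f$ is a homomorphism if $uRz$ implies $f(u)R'f(z)$ and $u\in V(p)$ implies $f(u)\in V'(p)$; an injective homomorphism if moreover injective; an embedding if injective and $uRz$ iff $f(u)R'f(z)$ and $u\in V(p)$ iff $f(u)\in V'(p)$. Each notion yields a relation $(\mathfrak{M},w)\preceq(\mathfrak{N},v)$ iff such a map exists. A well-quasi-order is a reflexive, transitive relation such that every infinite sequence $a_1,a_2,\dots$ contains $i<j$ with $a_i\preceq a_j$. -}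

module Defs where

open import Data.Nat using (ℕ; zero; suc; _<_; _≤_)
open import Data.Fin using (Fin)
open import Data.Bool using (Bool; T)
open import Data.Product using (Σ; ∃; ∃-syntax; _×_; _,_; proj₁)
open import Relation.Binary.PropositionalEquality using (_≡_)
open import Function.Definitions using (Injective)
open import Relation.Unary using (Pred)

-- The set of worlds is Fin (suc n) (finite, non-empty),
-- R and V are given by their (Boolean) characteristic functions.
record PointedModel (k : ℕ) : Set where
  constructor pointed
  field
    size : ℕ
    R    : Fin (suc size) → Fin (suc size) → Bool
    V    : Fin k → Fin (suc size) → Bool
    root : Fin (suc size)

World : ∀ {k} → PointedModel k → Set
World M = Fin (suc (PointedModel.size M))

data Path {k : ℕ} (M : PointedModel k) : World M → World M → Set where
  here : ∀ {u} → Path M u u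
  step : ∀ {u x v} → T (PointedModel.R M u x) → Path M x v → Path M u v

pathLength : ∀ {k} {M : PointedModel k} {u v : World M} → Path M u v → ℕ
pathLength here       = zero
pathLength (step _ p) = suc (pathLength p)

TreeShaped : ∀ {k} → PointedModel k → Set
TreeShaped M = (v : World M) →
  Path M (PointedModel.root M) v ×
  ((p q : Path M (PointedModel.root M) v) → p ≡ q)

HeightAtLeast : ∀ {k} → PointedModel k → ℕ → Set
HeightAtLeast M h = ∃[ v ] Σ (Path M (PointedModel.root M) v) λ p → h ≤ pathLength p

module _ {k : ℕ} (M N : PointedModel k) where
  private
    module M = PointedModel M
    module N = PointedModel N

  IsHom : (World M → World N) → Set
  IsHom f = f M.root ≡ N.root ×
    (∀ u z → T (M.R u z) → T (N.R (f u) (f z))) ×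
    (∀ p u → T (M.V p u) → T (N.V p (f u)))

  IsInjHom : (World M → World N) → Set
  IsInjHom f = IsHom f × Injective _≡_ _≡_ f

  IsEmbedding : (World M → World N) → Set
  IsEmbedding f = IsInjHom f ×
    (∀ u z → T (N.R (f u) (f z)) → T (M.R u z)) ×
    (∀ p u → T (N.V p (f u)) → T (M.V p u))

_≼hom_ : ∀ {k} → PointedModel k → PointedModel k → Set
M ≼hom N = ∃[ f ] IsHom M N f

_≼inj_ : ∀ {k} → PointedModel k → PointedModel k → Set
M ≼inj N = ∃[ f ] IsInjHom M N f

_≼emb_ : ∀ {k} → PointedModel k → PointedModel k → Set
M ≼emb N = ∃[ f ] IsEmbedding M N f

IsWQO : {A : Set} → (A → A → Set) → Set
IsWQO {A} _≼_ =
  (∀ a → a ≼ a) ×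
  (∀ {a b c} → a ≼ b → b ≼ c → a ≼ c) ×
  ((s : ℕ → A) → ∃[ i ] ∃[ j ] (i < j × s i ≼ s j))

Class : ℕ → Set₁
Class k = Pred (PointedModel k) _

Restrict : ∀ {k} (C : Class k) → (PointedModel k → PointedModel k → Set) →
           Σ (PointedModel k) C → Σ (PointedModel k) C → Set
Restrict C _≼_ a b = proj₁ a ≼ proj₁ b

TreeClassUnbounded : ∀ {k} → Class k → Set
TreeClassUnbounded C =
  (∀ M → C M → TreeShaped M) × (∀ h → ∃[ M ] (C M × HeightAtLeast M h))

-- The labelled paths  0 → 1 → ⋯ → n  with p true exactly at the last world
-- form an infinite antichain even for homomorphisms.  A homomorphism sends
-- the unique path from the root to a world onto a path of the same length
-- from the root, so it preserves depth; but p forces the last world of the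
-- path of length i to go to the last world of the path of length j, so i ≡ j.
module Submission where

open import Defs
open import Data.Nat using (ℕ; zero; suc; _+_; _≡ᵇ_; _<_)
open import Data.Nat.Properties
  using (≡ᵇ⇒≡; ≡⇒≡ᵇ; suc-injective; +-identityʳ; +-suc; +-cancelˡ-≡; ≤-reflexive; <⇒≢)
open import Data.Fin using (toℕ; fromℕ; inject₁) renaming (zero to fz; suc to fs)
open import Data.Fin.Properties using (toℕ-injective; toℕ-inject₁; toℕ-fromℕ)
open import Data.Bool using (T)
open import Data.Bool.Properties using (T-irrelevant)
open import Data.Product using (∃-syntax; _×_; _,_; proj₁; proj₂)
open import Function using (id)
open import Relation.Nullary using (¬_)
open import Relation.Binary.PropositionalEquality
open ≡-Reasoning

module _ {k : ℕ} {M : PointedModel k} where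
  open PointedModel M

  snoc : ∀ {u x v} → Path M u x → T (R x v) → Path M u v
  snoc here       r = step r here
  snoc (step s p) r = step s (snoc p r)

  Functional : Set
  Functional = ∀ {u x y} → T (R u x) → T (R u y) → x ≡ y

  path-unique-by-length : Functional → ∀ {u v} (p q : Path M u v) →
                          pathLength p ≡ pathLength q → p ≡ q
  path-unique-by-length R-fun here       here       _ = refl
  path-unique-by-length R-fun (step r p) (step s q) e with R-fun r s
  ... | refl = cong₂ step (T-irrelevant r s) (path-unique-by-length R-fun p q (suc-injective e))

module _ {k : ℕ} {M N : PointedModel k} (f : World M → World N)
         (f-R : ∀ u z → T (PointedModel.R M u z) → T (PointedModel.R N (f u) (f z))) where

  map-Path : ∀ {u v} → Path M u v → Path N (f u) (f v)
  map-Path here       = here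
  map-Path (step r p) = step (f-R _ _ r) (map-Path p)

  pathLength-map-Path : ∀ {u v} (p : Path M u v) → pathLength (map-Path p) ≡ pathLength p
  pathLength-map-Path here       = refl
  pathLength-map-Path (step r p) = cong suc (pathLength-map-Path p)

≼emb⇒≼hom : ∀ {k} {M N : PointedModel k} → M ≼emb N → M ≼hom N
≼emb⇒≼hom (f , (hom , _) , _) = f , hom

≼inj⇒≼hom : ∀ {k} {M N : PointedModel k} → M ≼inj N → M ≼hom N
≼inj⇒≼hom (f , hom , _) = f , hom

bad-sequence⇒¬IsWQO : {A : Set} {_≼_ : A → A → Set} (s : ℕ → A) →
                      (∀ {i j} → i < j → ¬ s i ≼ s j) → ¬ IsWQO _≼_
bad-sequence⇒¬IsWQO s bad (_ , _ , good) =
  let (i , j , i<j , sᵢ≼sⱼ) = good s in bad i<j sᵢ≼sⱼ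

labelledPath : ℕ → PointedModel 1
labelledPath n = pointed n (λ u z → toℕ z ≡ᵇ suc (toℕ u)) (λ _ u → toℕ u ≡ᵇ n) fz

module _ {n : ℕ} where
  open PointedModel (labelledPath n) using (R; V)

  R⇒toℕ-suc : ∀ {u z} → T (R u z) → toℕ z ≡ suc (toℕ u)
  R⇒toℕ-suc {u} {z} = ≡ᵇ⇒≡ (toℕ z) (suc (toℕ u))

  toℕ-suc⇒R : ∀ {u z} → toℕ z ≡ suc (toℕ u) → T (R u z)
  toℕ-suc⇒R {u} {z} = ≡⇒≡ᵇ (toℕ z) (suc (toℕ u))

  V⇒last : ∀ p {u} → T (V p u) → toℕ u ≡ n
  V⇒last _ {u} = ≡ᵇ⇒≡ (toℕ u) n

  last⇒V : ∀ p {u} → toℕ u ≡ n → T (V p u)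
  last⇒V _ {u} = ≡⇒≡ᵇ (toℕ u) n

  toℕ-+-pathLength : ∀ {u v} (p : Path (labelledPath n) u v) → toℕ u + pathLength p ≡ toℕ v
  toℕ-+-pathLength {u} here       = +-identityʳ (toℕ u)
  toℕ-+-pathLength {u} (step {x = x} r p) = begin
    toℕ u + suc (pathLength p) ≡⟨ +-suc (toℕ u) (pathLength p) ⟩
    suc (toℕ u) + pathLength p ≡⟨ cong (_+ pathLength p) (sym (R⇒toℕ-suc r)) ⟩
    toℕ x + pathLength p       ≡⟨ toℕ-+-pathLength p ⟩
    toℕ _                      ∎

  R-functional : Functional {M = labelledPath n}
  R-functional r s = toℕ-injective (trans (R⇒toℕ-suc r) (sym (R⇒toℕ-suc s)))

  path-unique : ∀ {u v} (p q : Path (labelledPath n) u v) → p ≡ q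
  path-unique {u} p q = path-unique-by-length R-functional p q
    (+-cancelˡ-≡ (toℕ u) _ _ (trans (toℕ-+-pathLength p) (sym (toℕ-+-pathLength q))))

  -- Indexed by the depth d, since inject₁ v is not structurally smaller than fs v.
  path-from-root : ∀ d (v : World (labelledPath n)) → toℕ v ≡ d → Path (labelledPath n) fz v
  path-from-root zero    fz     _ = here
  path-from-root (suc d) (fs v) e =
    snoc (path-from-root d (inject₁ v) (trans (toℕ-inject₁ v) (suc-injective e)))
         (toℕ-suc⇒R (cong suc (sym (toℕ-inject₁ v))))

  labelledPath-treeShaped : TreeShaped (labelledPath n)
  labelledPath-treeShaped v = path-from-root (toℕ v) v refl , path-unique

labelledPath-height : ∀ n → HeightAtLeast (labelledPath n) n
labelledPath-height n = fromℕ n , p , ≤-reflexive (sym (trans (toℕ-+-pathLength p) (toℕ-fromℕ n)))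
  where
  p : Path (labelledPath n) fz (fromℕ n)
  p = path-from-root n (fromℕ n) (toℕ-fromℕ n)

module _ {i j : ℕ} (f : World (labelledPath i) → World (labelledPath j))
         (hom : IsHom (labelledPath i) (labelledPath j) f) where
  private
    module Lᵢ = PointedModel (labelledPath i)
    module Lⱼ = PointedModel (labelledPath j)

    f-root : f fz ≡ fz
    f-root = proj₁ hom

    f-R : ∀ u z → T (Lᵢ.R u z) → T (Lⱼ.R (f u) (f z))
    f-R = proj₁ (proj₂ hom)

    f-V : ∀ p u → T (Lᵢ.V p u) → T (Lⱼ.V p (f u))
    f-V = proj₂ (proj₂ hom)

  hom-preserves-depth : ∀ v → toℕ (f v) ≡ toℕ v
  hom-preserves-depth v = begin
    toℕ (f v)                     ≡⟨ sym (toℕ-+-pathLength fp) ⟩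
    toℕ (f fz) + pathLength fp    ≡⟨ cong₂ _+_ (cong toℕ f-root) (pathLength-map-Path f f-R p) ⟩
    pathLength p                  ≡⟨ toℕ-+-pathLength p ⟩
    toℕ v                         ∎
    where
    p : Path (labelledPath i) fz v
    p = path-from-root (toℕ v) v refl

    fp : Path (labelledPath j) (f fz) (f v)
    fp = map-Path f f-R p

  hom⇒lengths-≡ : i ≡ j
  hom⇒lengths-≡ = begin
    i                 ≡⟨ sym (toℕ-fromℕ i) ⟩
    toℕ (fromℕ i)     ≡⟨ sym (hom-preserves-depth (fromℕ i)) ⟩
    toℕ (f (fromℕ i)) ≡⟨ V⇒last fz (f-V fz (fromℕ i) (last⇒V fz (toℕ-fromℕ i))) ⟩
    j                 ∎

LabelledPaths : Class 1
LabelledPaths M = ∃[ n ] M ≡ labelledPath n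

labelledPaths-unbounded : TreeClassUnbounded LabelledPaths
labelledPaths-unbounded =
  (λ { _ (n , refl) → labelledPath-treeShaped }) ,
  λ h → labelledPath h , (h , refl) , labelledPath-height h

labelledPaths-¬IsWQO : {_≼_ : PointedModel 1 → PointedModel 1 → Set} →
                       (∀ {M N} → M ≼ N → M ≼hom N) → ¬ IsWQO (Restrict LabelledPaths _≼_)
labelledPaths-¬IsWQO ≼⇒≼hom = bad-sequence⇒¬IsWQO (λ n → labelledPath n , n , refl)
  λ i<j Lᵢ≼Lⱼ → let (f , hom) = ≼⇒≼hom Lᵢ≼Lⱼ in <⇒≢ i<j (hom⇒lengths-≡ f hom)

theorem3p4 : ∃[ k ] ∃[ C₁ ] ∃[ C₂ ] ∃[ C₃ ]
    ((TreeClassUnbounded {k} C₁ × ¬ IsWQO (Restrict C₁ _≼emb_)) ×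
     (TreeClassUnbounded {k} C₂ × ¬ IsWQO (Restrict C₂ _≼inj_)) ×
     (TreeClassUnbounded {k} C₃ × ¬ IsWQO (Restrict C₃ _≼hom_)))
theorem3p4 = 1 , LabelledPaths , LabelledPaths , LabelledPaths ,
  (labelledPaths-unbounded , labelledPaths-¬IsWQO λ {M N} → ≼emb⇒≼hom {M = M} {N}) ,
  (labelledPaths-unbounded , labelledPaths-¬IsWQO λ {M N} → ≼inj⇒≼hom {M = M} {N}) ,
  (labelledPaths-unbounded , labelledPaths-¬IsWQO id)
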